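{- Let $n$ and $p$ be positive integers. Let $O_1$ and $O_2$ be finite sequences of distinct objects ("vertices"), let $k$ be a single vertex, and let $P$ be a sequence of $p$ vertices, such that all vertices in $O_1$, $k$, $O_2$, $P$ are pairwise distinct and their total number is at most $n$. Define two arrangements: the arrangement "at index $i$" is the concatenation $O_1, P, k, O_2$, and the arrangement "at index $i+1$" is the concatenation $O_1, k, P, O_2$. For a vertex $w$, let $\pi_i[w]$ (resp. $\pi_{i+1}[w]$) be the position of $w$ (counted from $0$) in the arrangement at index $i$ (resp. $i+1$). For integers $a,b$ let $d_C(a,b)=\min\{|a-b|,\ n-|a-b|\}$, and for vertices $x,y$ set $CBS^{(i)}(x,y)=d_C(\pi_i[x],\pi_i[y])$ and $CBS^{(i+1)}(x,y)=d_C(\pi_{i+1}[x],\pi_{i+1}[y])$. Let $u$ be a vertex of $P$, $v$ a vertex of $O_2$, and $\Delta=\pi_i[v]-\pi_i[u]$. Then: 1. if $\Delta \le \frac{n}{2}$, then $CBS^{(i+1)}(u,v)=CBS^{(i)}(u,v)-1$; 2. if $\Delta \ge \frac{n}{2}+1$, then $CBS^{(i+1)}(u,v)=CBS^{(i)}(u,v)+1$; 3. if $\frac{n}{2}<\Delta<\frac{n}{2}+1$, then $CBS^{(i+1)}(u,v)=CBS^{(i)}(u,v)$.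
   Context: This arises when a path $P$ of $p$ vertices is inserted into a partial labeling (a list of vertices of a graph with $n$ vertices, the label of a vertex being its position in the list) either just before the vertex $k$ (index $i$) or just after it (index $i+1$); $d_C$ is the cyclic distance between labels on a cycle with $n$ positions. -}

module Defs where

open import Data.Nat using (ℕ; zero; suc)
open import Data.Integer using (ℤ; +_; _-_; ∣_∣; _⊓_)
open import Data.List using (List; []; _∷_)
open import Relation.Binary.Definitions using (DecidableEquality)
open import Relation.Nullary using (yes; no)

-- position (counted from 0) of the first occurrence of w in a list;
-- only used for w occurring in the list (which is then unique)
module _ {A : Set} (_≟_ : DecidableEquality A) where
  pos : List A → A → ℕ
  pos [] w = zero
  pos (x ∷ xs) w with x ≟ w
  ... | yes _ = zero
  ... | no _  = suc (pos xs w)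

dC : ℕ → ℤ → ℤ → ℤ
dC n a b = (+ ∣ a - b ∣) ⊓ (+ n - + ∣ a - b ∣)

-- Moving P from before k to after it brings every vertex u of P one step
-- closer to every vertex v of O₂: if v lies d + 1 places after u in the first
-- arrangement, it lies d places after u in the second, and d + 1 ≤ n since the
-- arrangements have at most n vertices. Writing n = (d + 1) + t, the two cyclic
-- distances are (d + 1) ⊓ t and d ⊓ (t + 1); these differ by exactly one,
-- with the sign of t − d, unless d = t, i.e. unless 2Δ = n + 1.
module Submission where

open import Defs
open import Data.Nat using (ℕ; suc; _≤_)
open import Data.Integer using (ℤ; +_; _-_; _*_) renaming (_≤_ to _≤ℤ_; _+_ to _+ℤ_)
open import Data.List using (List; _∷_; _++_; length)
open import Data.List.Membership.Propositional using (_∈_)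
open import Data.List.Relation.Unary.Unique.Propositional using (Unique)
open import Relation.Binary.Definitions using (DecidableEquality)
open import Relation.Binary.PropositionalEquality using (_≡_)
open import Data.Product using (_×_)

open import Data.List using ([])
open import Data.Nat using (_+_; _∸_; _<_; _⊓_; s≤s; z≤n; s≤s⁻¹)
import Data.Nat as ℕ
open import Data.Nat.Properties
  using ( +-identityʳ; +-assoc; +-comm; +-suc; +-cancelˡ-≤; +-cancelˡ-≡; ⊓-comm
        ; m≤n⇒m⊓n≡m; m≥n⇒m⊓n≡n; m<n⇒m≤1+n; m≤n⇒∃[o]m+o≡n
        ; m≤n+m; m≤m+n; m+n∸m≡n; <⇒≤; ≤-trans; <-≤-trans; suc-injective)
open import Data.Integer using (_⊖_)
open import Data.Integer.Properties using ([+m]-[+n]≡m⊖n; ≤-⊖; ∣i-j∣≡∣j-i∣; drop‿+≤+; +-injective)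
open import Data.List.Properties using (++-assoc; length-++)
open import Data.List.Relation.Unary.All as All using ()
open import Data.List.Relation.Unary.AllPairs using (_∷_)
open import Data.List.Relation.Unary.Any using (here; there)
open import Data.List.Membership.Propositional.Properties using (∈-++⁺ʳ; ∈-∃++)
open import Data.List.Relation.Binary.Permutation.Propositional using (_↭_; prep; ↭⇒↭ₛ)
open import Data.List.Relation.Binary.Permutation.Propositional.Properties
  using (↭-length; ++⁺ˡ) renaming (++-comm to ++-comm-↭)
import Data.List.Relation.Binary.Permutation.Setoid.Properties as ↭ₛ
open import Relation.Binary.Definitions using (_Respects_)
open import Relation.Binary.PropositionalEquality
  using (refl; sym; trans; cong; subst; subst₂; setoid; module ≡-Reasoning)
open import Data.Empty using (⊥-elim)
open import Data.Product using (_,_; ∃)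
open import Relation.Nullary using (yes; no)

2*m≡m+m : ∀ m → 2 ℕ.* m ≡ m + m
2*m≡m+m m = cong (λ k → m + k) (+-identityʳ m)

2*m≤m+n⇒m≤n : ∀ {m n} → 2 ℕ.* m ≤ m + n → m ≤ n
2*m≤m+n⇒m≤n {m} {n} h = +-cancelˡ-≤ m m n (subst (_≤ m + n) (2*m≡m+m m) h)

m+n+2≤2*m⇒2+n≤m : ∀ {m n} → m + n + 2 ≤ 2 ℕ.* m → 2 + n ≤ m
m+n+2≤2*m⇒2+n≤m {m} {n} h = +-cancelˡ-≤ m (2 + n) m (subst₂ _≤_ m+n+2≡m+[2+n] (2*m≡m+m m) h)
  where
  m+n+2≡m+[2+n] : m + n + 2 ≡ m + (2 + n)
  m+n+2≡m+[2+n] = trans (+-assoc m n 2) (cong (λ k → m + k) (+-comm n 2))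

2*m≡m+n+1⇒m≡1+n : ∀ {m n} → 2 ℕ.* m ≡ m + n + 1 → m ≡ 1 + n
2*m≡m+n+1⇒m≡1+n {m} {n} h = +-cancelˡ-≡ m m (1 + n) (begin
  m + m        ≡⟨ sym (2*m≡m+m m) ⟩
  2 ℕ.* m      ≡⟨ h ⟩
  m + n + 1    ≡⟨ +-assoc m n 1 ⟩
  m + (n + 1)  ≡⟨ cong (λ k → m + k) (+-comm n 1) ⟩
  m + (1 + n)  ∎)
  where open ≡-Reasoning

m<n⇒[1+m]⊓n≡1+[m⊓[1+n]] : ∀ {m n} → m < n → suc m ⊓ n ≡ suc (m ⊓ suc n)
m<n⇒[1+m]⊓n≡1+[m⊓[1+n]] m<n =
  trans (m≤n⇒m⊓n≡m m<n) (cong suc (sym (m≤n⇒m⊓n≡m (m<n⇒m≤1+n m<n))))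

n<m⇒m⊓[1+n]≡1+[[1+m]⊓n] : ∀ {m n} → n < m → m ⊓ suc n ≡ suc (suc m ⊓ n)
n<m⇒m⊓[1+n]≡1+[[1+m]⊓n] n<m =
  trans (m≥n⇒m⊓n≡n n<m) (cong suc (sym (m≥n⇒m⊓n≡n (m<n⇒m≤1+n n<m))))

+[m+n]-+m≡+n : ∀ m n → + (m + n) - + m ≡ + n
+[m+n]-+m≡+n m n = begin
  + (m + n) - + m  ≡⟨ [+m]-[+n]≡m⊖n (m + n) m ⟩
  (m + n) ⊖ m      ≡⟨ ≤-⊖ (m≤m+n m n) ⟩
  + (m + n ∸ m)    ≡⟨ cong +_ (m+n∸m≡n m n) ⟩
  + n              ∎
  where open ≡-Reasoning

dC-+ : ∀ {n} x d t → d + t ≡ n → dC n (+ x) (+ (x + d)) ≡ + (d ⊓ t)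
dC-+ x d t refl
  rewrite ∣i-j∣≡∣j-i∣ (+ x) (+ (x + d)) | +[m+n]-+m≡+n x d | +[m+n]-+m≡+n d t = refl

cyclic-distance-shift : ∀ {n} x y d → suc d ≤ n →
    let CBSi  = dC n (+ x) (+ (x + suc d))
        CBSi1 = dC n (+ y) (+ (y + d))
        Δ = + (x + suc d) - + x
    in ((+ 2) * Δ ≤ℤ + n → CBSi1 ≡ CBSi - + 1)
     × (+ n +ℤ + 2 ≤ℤ (+ 2) * Δ → CBSi1 ≡ CBSi +ℤ + 1)
     × ((+ 2) * Δ ≡ + n +ℤ + 1 → CBSi1 ≡ CBSi)
cyclic-distance-shift x y d 1+d≤n with t , refl ← m≤n⇒∃[o]m+o≡n 1+d≤n
  rewrite +[m+n]-+m≡+n x (suc d) | dC-+ x (suc d) t refl | dC-+ y d (suc t) (+-suc d t)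
  = below-half , above-half , at-half
  where
  below-half : (+ 2) * + suc d ≤ℤ + (suc d + t) → + (d ⊓ suc t) ≡ + (suc d ⊓ t) - + 1
  below-half h rewrite m<n⇒[1+m]⊓n≡1+[m⊓[1+n]] (2*m≤m+n⇒m≤n (drop‿+≤+ h)) = refl

  above-half : + (suc d + t) +ℤ + 2 ≤ℤ (+ 2) * + suc d → + (d ⊓ suc t) ≡ + (suc d ⊓ t) +ℤ + 1
  above-half h rewrite n<m⇒m⊓[1+n]≡1+[[1+m]⊓n] (s≤s⁻¹ (m+n+2≤2*m⇒2+n≤m (drop‿+≤+ h))) =
    cong +_ (+-comm 1 (suc d ⊓ t))

  at-half : (+ 2) * + suc d ≡ + (suc d + t) +ℤ + 1 → + (d ⊓ suc t) ≡ + (suc d ⊓ t)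
  at-half h rewrite suc-injective (2*m≡m+n+1⇒m≡1+n (+-injective h)) = cong +_ (⊓-comm t (suc t))

Unique-resp-↭ : {A : Set} → Unique {A = A} Respects _↭_
Unique-resp-↭ {A} σ = ↭ₛ.Unique-resp-↭ (setoid A) (↭⇒↭ₛ σ)

insert-before-↭ : {A : Set} (O₁ O₂ P : List A) (k : A) → O₁ ++ k ∷ O₂ ++ P ↭ O₁ ++ P ++ k ∷ O₂
insert-before-↭ O₁ O₂ P k = ++⁺ˡ O₁ (++-comm-↭ (k ∷ O₂) P)

insert-after-↭ : {A : Set} (O₁ O₂ P : List A) (k : A) → O₁ ++ k ∷ O₂ ++ P ↭ O₁ ++ k ∷ P ++ O₂
insert-after-↭ O₁ O₂ P k = ++⁺ˡ O₁ (prep k (++-comm-↭ O₂ P))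

module _ {A : Set} (_≟_ : DecidableEquality A) where

  pos-< : ∀ {w} xs → w ∈ xs → pos _≟_ xs w < length xs
  pos-< {w} (x ∷ xs) w∈x∷xs with x ≟ w | w∈x∷xs
  ... | yes _   | _           = s≤s z≤n
  ... | no x≢w  | here refl   = ⊥-elim (x≢w refl)
  ... | no _    | there w∈xs  = s≤s (pos-< xs w∈xs)

  pos-unique : ∀ {w} xs ys → Unique (xs ++ w ∷ ys) → pos _≟_ (xs ++ w ∷ ys) w ≡ length xs
  pos-unique {w} [] ys _ with w ≟ w
  ... | yes _   = refl
  ... | no w≢w  = ⊥-elim (w≢w refl)
  pos-unique {w} (x ∷ xs) ys (x∉ ∷ uniq) with x ≟ w
  ... | yes refl = ⊥-elim (All.lookup x∉ (∈-++⁺ʳ xs (here refl)) refl)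
  ... | no _     = cong suc (pos-unique xs ys uniq)

  pos-gap : ∀ {u v} xs ys zs → let L = xs ++ u ∷ ys ++ v ∷ zs in
    Unique L → pos _≟_ L v ≡ pos _≟_ L u + suc (length ys)
  pos-gap {u} {v} xs ys zs uniq = begin
    pos _≟_ (xs ++ u ∷ ys ++ v ∷ zs) v    ≡⟨ cong (λ L → pos _≟_ L v) reassoc ⟩
    pos _≟_ ((xs ++ u ∷ ys) ++ v ∷ zs) v  ≡⟨ pos-unique (xs ++ u ∷ ys) zs (subst Unique reassoc uniq) ⟩
    length (xs ++ u ∷ ys)                 ≡⟨ length-++ xs ⟩
    length xs + suc (length ys)           ≡⟨ cong (_+ suc (length ys)) (pos-unique xs _ uniq) ⟨
    pos _≟_ (xs ++ u ∷ ys ++ v ∷ zs) u + suc (length ys) ∎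
    where
    open ≡-Reasoning
    reassoc : xs ++ u ∷ ys ++ v ∷ zs ≡ (xs ++ u ∷ ys) ++ v ∷ zs
    reassoc = sym (++-assoc xs (u ∷ ys) (v ∷ zs))

  insertion-gaps : ∀ {O₁ O₂ P k u v} →
    Unique (O₁ ++ k ∷ O₂ ++ P) → u ∈ P → v ∈ O₂ →
    ∃ λ g → pos _≟_ (O₁ ++ P ++ k ∷ O₂) v ≡ pos _≟_ (O₁ ++ P ++ k ∷ O₂) u + suc (suc g)
          × pos _≟_ (O₁ ++ k ∷ P ++ O₂) v ≡ pos _≟_ (O₁ ++ k ∷ P ++ O₂) u + suc g
  insertion-gaps {O₁} {O₂} {P} {k} {u} {v} uniq u∈P v∈O₂
    with P₁ , P₂ , refl ← ∈-∃++ u∈P | Q₁ , Q₂ , refl ← ∈-∃++ v∈O₂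
    = length P₂ + length Q₁
    , gap-along (O₁ ++ P₁) (P₂ ++ k ∷ Q₁) Q₂ (trans (length-++ P₂) (+-suc _ _))
        (reassoc O₁ P₁ (k ∷ Q₁)) (Unique-resp-↭ (insert-before-↭ O₁ O₂ P k) uniq)
    , gap-along (O₁ ++ k ∷ P₁) (P₂ ++ Q₁) Q₂ (length-++ P₂)
        (reassoc O₁ (k ∷ P₁) Q₁) (Unique-resp-↭ (insert-after-↭ O₁ O₂ P k) uniq)
    where
    gap-along : ∀ {L g} xs ys zs → length ys ≡ g → L ≡ xs ++ u ∷ ys ++ v ∷ zs → Unique L →
      pos _≟_ L v ≡ pos _≟_ L u + suc g
    gap-along xs ys zs refl refl = pos-gap xs ys zs

    reassoc : ∀ xs ys zs →
      xs ++ (ys ++ u ∷ P₂) ++ zs ++ v ∷ Q₂ ≡ (xs ++ ys) ++ u ∷ (P₂ ++ zs) ++ v ∷ Q₂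
    reassoc xs ys zs = begin
      xs ++ (ys ++ u ∷ P₂) ++ zs ++ v ∷ Q₂  ≡⟨ cong (xs ++_) (++-assoc ys (u ∷ P₂) _) ⟩
      xs ++ ys ++ u ∷ P₂ ++ zs ++ v ∷ Q₂    ≡⟨ ++-assoc xs ys _ ⟨
      (xs ++ ys) ++ u ∷ P₂ ++ zs ++ v ∷ Q₂  ≡⟨ cong (λ l → (xs ++ ys) ++ u ∷ l) (++-assoc P₂ zs (v ∷ Q₂)) ⟨
      (xs ++ ys) ++ u ∷ (P₂ ++ zs) ++ v ∷ Q₂ ∎
      where open ≡-Reasoning

theorem5 : {A : Set} (_≟_ : DecidableEquality A) (n p : ℕ) → 1 ≤ n → 1 ≤ p →
    (O₁ O₂ P : List A) (k : A) → length P ≡ p →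
    Unique (O₁ ++ k ∷ O₂ ++ P) → length (O₁ ++ k ∷ O₂ ++ P) ≤ n →
    (u v : A) → u ∈ P → v ∈ O₂ →
    let πi  = λ w → + pos _≟_ (O₁ ++ P ++ k ∷ O₂) w
        πi1 = λ w → + pos _≟_ (O₁ ++ k ∷ P ++ O₂) w
        CBSi  = dC n (πi u) (πi v)
        CBSi1 = dC n (πi1 u) (πi1 v)
        Δ = πi v - πi u
    in ((+ 2) * Δ ≤ℤ + n → CBSi1 ≡ CBSi - + 1)
     × (+ n +ℤ + 2 ≤ℤ (+ 2) * Δ → CBSi1 ≡ CBSi +ℤ + 1)
     × ((+ 2) * Δ ≡ + n +ℤ + 1 → CBSi1 ≡ CBSi)
theorem5 _≟_ n _ _ _ O₁ O₂ P k _ uniq len u v u∈P v∈O₂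
  with g , gapᵢ , gapᵢ₊₁ ← insertion-gaps _≟_ uniq u∈P v∈O₂
  rewrite gapᵢ | gapᵢ₊₁
  = cyclic-distance-shift (pos _≟_ (O₁ ++ P ++ k ∷ O₂) u) (pos _≟_ (O₁ ++ k ∷ P ++ O₂) u) (suc g)
      (≤-trans (m≤n+m _ _) (<⇒≤ (subst (_< n) gapᵢ vᵢ<n)))
  where
  vᵢ<n : pos _≟_ (O₁ ++ P ++ k ∷ O₂) v < n
  vᵢ<n = <-≤-trans (pos-< _≟_ _ (∈-++⁺ʳ O₁ (∈-++⁺ʳ P (there v∈O₂))))
                   (subst (_≤ n) (↭-length (insert-before-↭ O₁ O₂ P k)) len)
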